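{- Let $\mathcal{F}$ be a finite set of graphs and $G=(V_G,E_G)$ a graph. Consider the linear program with a variable $x_{uv}\in[0,1]$ for every unordered node pair $\{u,v\}\subseteq V_G$, the constraints $$\sum_{\{u,v\}\in E_H}\bigl(1-x_{\pi(u)\pi(v)}\bigr)+\sum_{\{u,v\}\in \overline{E_H}} x_{\pi(u)\pi(v)}\ \ge 1\quad\text{for all } H\in\mathcal{F} \text{ and all injective } \pi: V_H\to V_G,$$ and objective $\min \sum_{\{u,v\}\in E_G}(1-x_{uv})+\sum_{\{u,v\}\in\overline{E_G}}x_{uv}$. Let $B$ be a (possibly empty) set of node pairs of $G$ ("blocked" pairs) and add to the LP the constraints $x_{uv}=1$ for $\{u,v\}\in B\cap E_G$ and $x_{uv}=0$ for $\{u,v\}\in B\cap\overline{E_G}$. Let $P$ be a set of induced forbidden subgraphs of $G$, i.e., pairs $(H,\pi)$ with $H\in\mathcal{F}$ and $\pi:V_H\to V_G$ injective such that $\{u,v\}\in E_H \iff \{\pi(u),\pi(v)\}\in E_G$, such that no two members of $P$ share a node pair of $V_G$ that is not in $B$. Then every feasible solution of this LP has objective value at least $|P|$. In particular (taking $B=\emptyset$), the optimal value of the LP relaxation is at least the size of any node-pair-disjoint packing of induced forbidden subgraphs of $G$.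
   Context: All graphs are finite, simple, undirected; $\overline{E}$ denotes the set of unordered node pairs that are not edges. Node pairs of a forbidden subgraph $(H,\pi)$ are the pairs $\{\pi(u),\pi(v)\}$ for distinct $u,v\in V_H$. The LP is the linear relaxation of the standard ILP for $\mathcal{F}$-free edge editing, where $x_{uv}=1$ means $\{u,v\}$ is an edge of the edited graph. -}

module Defs where

open import Level using (Level; _⊔_) renaming (suc to lsuc)
open import Data.Nat as ℕ using (ℕ; zero; suc)
open import Data.Bool using (Bool; true; false; if_then_else_; _∨_; T)
open import Data.Fin using (Fin; zero; suc; _<?_)
open import Data.List using (List; length; lookup)
open import Data.List.Membership.Propositional using (_∈_)
open import Data.Product using (Σ; _×_; _,_)
open import Data.Empty using (⊥)
open import Relation.Nullary using (¬_)
open import Relation.Nullary.Decidable using (⌊_⌋)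
open import Relation.Binary.PropositionalEquality using (_≡_; _≢_)
open import Relation.Binary using (Rel; IsTotalOrder)
open import Algebra.Bundles using (CommutativeRing)
open import Function.Definitions using (Injective)

-- Scalars: a (totally) ordered commutative ring (ℝ is an instance).

record OrderedCommutativeRing (c ℓ₁ ℓ₂ : Level) : Set (lsuc (c ⊔ ℓ₁ ⊔ ℓ₂)) where
  field
    commutativeRing : CommutativeRing c ℓ₁
  open CommutativeRing commutativeRing public
  field
    _≤_          : Rel Carrier ℓ₂
    isTotalOrder : IsTotalOrder _≈_ _≤_
    +-monoˡ-≤    : ∀ {x y} z → x ≤ y → (x + z) ≤ (y + z)
    *-nonneg     : ∀ {x y} → 0# ≤ x → 0# ≤ y → 0# ≤ (x * y)
    0≉1          : ¬ (0# ≈ 1#)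

record Graph : Set where
  field
    n       : ℕ
    adj     : Fin n → Fin n → Bool
    sym     : ∀ i j → adj i j ≡ adj j i
    irrefl  : ∀ i → adj i i ≡ false

open Graph public

record InducedForbidden (𝓕 : List Graph) (G : Graph) : Set where
  field
    H       : Graph
    H∈𝓕     : H ∈ 𝓕
    π       : Fin (n H) → Fin (n G)
    π-inj   : Injective _≡_ _≡_ π
    induced : ∀ u v → adj H u v ≡ adj G (π u) (π v)

open InducedForbidden public

-- {a , b} is a node pair of the forbidden subgraph o
-- (both orientations are covered since u , v range over all of V_H).
NodePairOf : ∀ {𝓕 G} → InducedForbidden 𝓕 G → Fin (n G) → Fin (n G) → Set
NodePairOf o a b = Σ (Fin (n (H o))) λ u → Σ (Fin (n (H o))) λ v →
  (u ≢ v) × (π o u ≡ a) × (π o v ≡ b)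

Blocked : ∀ {m} → (Fin m → Fin m → Bool) → Fin m → Fin m → Set
Blocked B a b = T (B a b ∨ B b a)

PairDisjoint : ∀ {𝓕} (G : Graph) → (Fin (n G) → Fin (n G) → Bool) →
               List (InducedForbidden 𝓕 G) → Set
PairDisjoint G B P = ∀ (k l : Fin (length P)) → k ≢ l →
  ∀ a b → ¬ Blocked B a b →
  NodePairOf (lookup P k) a b → NodePairOf (lookup P l) a b → ⊥

module LP {c ℓ₁ ℓ₂} (R : OrderedCommutativeRing c ℓ₁ ℓ₂) where
  open OrderedCommutativeRing R hiding (zero)

  sumFin : (m : ℕ) → (Fin m → Carrier) → Carrier
  sumFin zero    f = 0#
  sumFin (suc m) f = f zero + sumFin m (λ i → f (suc i))

  sumPairs : (m : ℕ) → (Fin m → Fin m → Carrier) → Carrier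
  sumPairs m f = sumFin m λ i → sumFin m λ j → if ⌊ i <? j ⌋ then f i j else 0#

  fromℕ : ℕ → Carrier
  fromℕ zero    = 0#
  fromℕ (suc k) = 1# + fromℕ k

  cost : Bool → Carrier → Carrier
  cost true  y = 1# - y
  cost false y = y

  -- an assignment of a variable x_{uv} to every unordered node pair
  -- (represented by a symmetric function; the diagonal is irrelevant)
  Assignment : Graph → Set c
  Assignment G = Fin (n G) → Fin (n G) → Carrier

  objective : (G : Graph) → Assignment G → Carrier
  objective G x = sumPairs (n G) λ u v → cost (adj G u v) (x u v)

  constraintLHS : (G H : Graph) → (Fin (n H) → Fin (n G)) → Assignment G → Carrier
  constraintLHS G H π x =
    sumPairs (n H) λ u v → cost (adj H u v) (x (π u) (π v))

  record Feasible (𝓕 : List Graph) (G : Graph)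
                  (B : Fin (n G) → Fin (n G) → Bool) (x : Assignment G) : Set (c ⊔ ℓ₁ ⊔ ℓ₂) where
    field
      symm      : ∀ u v → u ≢ v → x u v ≈ x v u
      lower     : ∀ u v → u ≢ v → 0# ≤ x u v
      upper     : ∀ u v → u ≢ v → x u v ≤ 1#
      forbidden : ∀ H → H ∈ 𝓕 → (π : Fin (n H) → Fin (n G)) →
                  Injective _≡_ _≡_ π → 1# ≤ constraintLHS G H π x
      blockedE  : ∀ u v → u ≢ v → Blocked B u v → adj G u v ≡ true  → x u v ≈ 1#
      blockedN  : ∀ u v → u ≢ v → Blocked B u v → adj G u v ≡ false → x u v ≈ 0#

-- Write weight a b for the editing cost of the node pair {a , b} of G,
-- counted once, at its sorted representative a < b; the objective is
-- ∑_{a,b} weight a b.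
-- A constraint row of the packing member (H , π) charges each of its own
-- node pairs {u , v} (u < v) to the sorted image pair of {π u , π v}, so
-- it splits as ∑_{a,b} ∑_{u,v} share u v a b, where share u v a b is
-- weight a b if (u , v) "hits" (a , b) and 0 otherwise.  Summing over the
-- packing and exchanging sums, |P| ≤ ∑_k row_k = ∑_{a,b} load a b, and it
-- remains to bound each load a b by weight a b:
--   * if {a , b} is blocked, the LP fixes x_ab so that weight a b = 0;
--   * otherwise at most one (k , u , v) hits (a , b): for a fixed member
--     because π is injective, across members because P is pair-disjoint.
module Submission where

open import Level using (_⊔_)
open import Defs
open import Data.Bool using (Bool; true; false; if_then_else_; _∨_)
open import Data.Nat using (ℕ; zero; suc)
import Data.Nat.Properties as ℕ
open import Data.Fin using (Fin; zero; suc; _<_; _<?_; _≟_; punchIn)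
open import Data.Fin.Properties using (suc-injective; <-asym; <⇒≢; ≤∧≢⇒<; punchInᵢ≢i)
open import Data.List using (List; length; lookup)
open import Data.Product using (∃; _×_; _,_; proj₁; proj₂)
open import Data.Sum using (_⊎_; inj₁; inj₂; map)
open import Data.Empty using (⊥; ⊥-elim)
open import Function using (_∘_)
open import Relation.Nullary using (¬_; Dec; yes; no)
open import Relation.Nullary.Decidable using (⌊_⌋; _×-dec_; T?)
open import Relation.Binary.PropositionalEquality as ≡ using (_≡_; _≢_)
open import Relation.Binary.Bundles using (Poset)
open import Relation.Binary.Structures using (IsTotalOrder)
import Relation.Binary.Reasoning.PartialOrder as PartialOrderReasoning
import Algebra.Properties.CommutativeMonoid.Sum as MonoidSum

flip-< : ∀ {m} {a b : Fin m} → a ≢ b → ¬ a < b → b < a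
flip-< a≢b a≮b = ≤∧≢⇒< (ℕ.≮⇒≥ a≮b) (a≢b ∘ ≡.sym)

crossed : ∀ {m} {u v u′ v′ : Fin m} → u < v → u′ < v′ → u ≡ v′ → v ≡ u′ → ⊥
crossed u<v u′<v′ u≡v′ v≡u′ = <-asym (≡.subst₂ _<_ u≡v′ v≡u′ u<v) u′<v′

module PackingBound {c ℓ₁ ℓ₂} (R : OrderedCommutativeRing c ℓ₁ ℓ₂) where
  open OrderedCommutativeRing R using (Carrier; _≈_; _≤_; _+_; -_; 0#; 1#;
    isTotalOrder; +-monoˡ-≤; +-congʳ; +-comm; +-congˡ; +-identityˡ;
    +-identityʳ; +-cong; -‿cong; -‿inverseʳ; +-commutativeMonoid)
    renaming (refl to ≈-refl; sym to ≈-sym; trans to ≈-trans)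
  open LP R
  open MonoidSum +-commutativeMonoid using (sum; sum-syntax; sum-cong-≋;
    sum-replicate-zero; sum-remove; ∑-comm)

  poset : Poset c ℓ₁ ℓ₂
  poset = record { isPartialOrder = IsTotalOrder.isPartialOrder isTotalOrder }

  open Poset poset using (reflexive) renaming (refl to ≤-refl; trans to ≤-trans)
  open PartialOrderReasoning poset

  -- Addition is monotone in both arguments (the structure only gives the left one).
  +-mono-≤ : ∀ {a b a′ b′} → a ≤ b → a′ ≤ b′ → (a + a′) ≤ (b + b′)
  +-mono-≤ {a} {b} {a′} {b′} a≤b a′≤b′ = begin
    a + a′  ≤⟨ +-monoˡ-≤ a′ a≤b ⟩
    b + a′  ≈⟨ +-comm b a′ ⟩
    a′ + b  ≤⟨ +-monoˡ-≤ b a′≤b′ ⟩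
    b′ + b  ≈⟨ +-comm b′ b ⟩
    b + b′  ∎

  sumFin≈∑ : ∀ m {f g : Fin m → Carrier} → (∀ i → f i ≈ g i) → sumFin m f ≈ ∑[ i < m ] g i
  sumFin≈∑ zero    f≈g = ≈-refl
  sumFin≈∑ (suc m) f≈g = +-cong (f≈g zero) (sumFin≈∑ m (f≈g ∘ suc))

  ∑-mono-≤ : ∀ {m} {f g : Fin m → Carrier} → (∀ i → f i ≤ g i) → (∑[ i < m ] f i) ≤ (∑[ i < m ] g i)
  ∑-mono-≤ {zero}  f≤g = ≤-refl
  ∑-mono-≤ {suc m} f≤g = +-mono-≤ (f≤g zero) (∑-mono-≤ (f≤g ∘ suc))

  ∑-vanishes : ∀ {m} {f : Fin m → Carrier} → (∀ i → f i ≈ 0#) → ∑[ i < m ] f i ≈ 0#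
  ∑-vanishes {m} f≈0 = ≈-trans (sum-cong-≋ f≈0) (sum-replicate-zero m)

  ∑-delta : ∀ {m} {f : Fin m → Carrier} (j : Fin m) → (∀ i → i ≢ j → f i ≈ 0#) →
            ∑[ i < m ] f i ≈ f j
  ∑-delta {suc m} {f} j off = begin-equality
    sum f                                   ≈⟨ sum-remove f ⟩
    f j + ∑[ i < m ] f (punchIn j i)        ≈⟨ +-congˡ (∑-vanishes (λ i → off _ (punchInᵢ≢i j i))) ⟩
    f j + 0#                                ≈⟨ +-identityʳ (f j) ⟩
    f j                                     ∎

  ∑-sink : ∀ {k m l} (f : Fin k → Fin m → Fin l → Carrier) →
           ∑[ i < k ] ∑[ a < m ] ∑[ b < l ] f i a b ≈ ∑[ a < m ] ∑[ b < l ] ∑[ i < k ] f i a b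
  ∑-sink f = ≈-trans (∑-comm (λ i a → ∑[ b < _ ] f i a b)) (sum-cong-≋ (λ a → ∑-comm (λ i b → f i a b)))

  fromℕ≈∑1 : ∀ k → fromℕ k ≈ ∑[ i < k ] 1#
  fromℕ≈∑1 zero    = ≈-refl
  fromℕ≈∑1 (suc k) = +-congˡ (fromℕ≈∑1 k)

  Charged : Carrier → Set → Carrier → Set (ℓ₁ ⊔ ℓ₂)
  Charged q Q F = (F ≤ q) × (F ≈ 0# ⊎ Q)

  charged-map : ∀ {q F} {Q Q′ : Set} → (Q → Q′) → Charged q Q F → Charged q Q′ F
  charged-map f (F≤q , inj₁ F≈0) = F≤q , inj₁ F≈0
  charged-map f (F≤q , inj₂ e)   = F≤q , inj₂ (f e)

  ∑-charged : ∀ {m q} {F : Fin m → Carrier} {Q : Fin m → Set} → 0# ≤ q →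
              (∀ i → Charged q (Q i) (F i)) → (∀ i j → Q i → Q j → i ≡ j) →
              Charged q (∃ Q) (∑[ i < m ] F i)
  ∑-charged {zero} 0≤q _ _ = 0≤q , inj₁ ≈-refl
  ∑-charged {suc m} {q} {F} {Q} 0≤q charged unique with charged zero
  ... | _ , inj₁ F₀≈0 = ≤-trans (reflexive dropF₀) (proj₁ tail) ,
                         map (≈-trans dropF₀) (λ (i , e) → suc i , e) (proj₂ tail)
    where
    tail : Charged q (∃ (Q ∘ suc)) (∑[ i < m ] F (suc i))
    tail = ∑-charged 0≤q (charged ∘ suc) (λ i j e e′ → suc-injective (unique _ _ e e′))
    dropF₀ : F zero + ∑[ i < m ] F (suc i) ≈ ∑[ i < m ] F (suc i)
    dropF₀ = ≈-trans (+-congʳ F₀≈0) (+-identityˡ _)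
  ... | F₀≤q , inj₂ e₀ = ≤-trans (reflexive onlyF₀) F₀≤q , inj₂ (zero , e₀)
    where
    tail-vanishes : ∀ i → F (suc i) ≈ 0#
    tail-vanishes i with proj₂ (charged (suc i))
    ... | inj₁ Fᵢ≈0 = Fᵢ≈0
    ... | inj₂ eᵢ with unique zero (suc i) e₀ eᵢ
    ... | ()
    onlyF₀ : F zero + ∑[ i < m ] F (suc i) ≈ F zero
    onlyF₀ = ≈-trans (+-congˡ (∑-vanishes tail-vanishes)) (+-identityʳ _)

  indicator : ∀ {A : Set} → Dec A → Carrier → Carrier
  indicator d y = if ⌊ d ⌋ then y else 0#

  indicator-yes : ∀ {A : Set} (d : Dec A) {y} → A → indicator d y ≈ y
  indicator-yes (yes _) _ = ≈-refl
  indicator-yes (no ¬a) a = ⊥-elim (¬a a)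

  indicator-when : ∀ {A : Set} (d : Dec A) {y} → (A → y ≈ 0#) → indicator d y ≈ 0#
  indicator-when (yes a) y≈0 = y≈0 a
  indicator-when (no _)  _   = ≈-refl

  indicator-no : ∀ {A : Set} (d : Dec A) {y} → ¬ A → indicator d y ≈ 0#
  indicator-no d ¬a = indicator-when d (⊥-elim ∘ ¬a)

  indicator-cases : ∀ {A : Set} (d : Dec A) {y z} → (A → y ≈ z) → (¬ A → z ≈ 0#) → indicator d y ≈ z
  indicator-cases (yes a)  y≈z _   = y≈z a
  indicator-cases (no ¬a)  _   z≈0 = ≈-sym (z≈0 ¬a)

  indicator-nonneg : ∀ {A : Set} (d : Dec A) {y} → (A → 0# ≤ y) → 0# ≤ indicator d y
  indicator-nonneg (yes a) 0≤y = 0≤y a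
  indicator-nonneg (no _)  _   = ≤-refl

  indicator-charged : ∀ {A : Set} (d : Dec A) {y} → 0# ≤ y → Charged y A (indicator d y)
  indicator-charged (yes a) 0≤y = ≤-refl , inj₂ a
  indicator-charged (no _)  0≤y = 0≤y , inj₁ ≈-refl

  cost-nonneg : ∀ β {y} → 0# ≤ y → y ≤ 1# → 0# ≤ cost β y
  cost-nonneg true  {y} _ y≤1 = ≤-trans (reflexive (≈-sym (-‿inverseʳ y))) (+-monoˡ-≤ (- y) y≤1)
  cost-nonneg false     0≤y _ = 0≤y

  cost-cong : ∀ β {y y′} → y ≈ y′ → cost β y ≈ cost β y′
  cost-cong true  y≈y′ = +-congˡ (-‿cong y≈y′)
  cost-cong false y≈y′ = y≈y′

  module Packing (𝓕 : List Graph) (G : Graph) (B : Fin (n G) → Fin (n G) → Bool)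
                 (P : List (InducedForbidden 𝓕 G)) (disjoint : PairDisjoint G B P)
                 (x : Assignment G) (feasible : Feasible 𝓕 G B x) where
    open Feasible feasible

    N : ℕ
    N = n G

    Member : Set
    Member = InducedForbidden 𝓕 G

    member : Fin (length P) → Member
    member = lookup P

    weight : Fin N → Fin N → Carrier
    weight a b = indicator (a <? b) (cost (adj G a b) (x a b))

    weight-nonneg : ∀ a b → 0# ≤ weight a b
    weight-nonneg a b = indicator-nonneg (a <? b) λ a<b →
      cost-nonneg (adj G a b) (lower a b (<⇒≢ a<b)) (upper a b (<⇒≢ a<b))

    objective≈∑weight : objective G x ≈ ∑[ a < N ] ∑[ b < N ] weight a b
    objective≈∑weight = sumFin≈∑ N (λ a → sumFin≈∑ N (λ b → ≈-refl))

    lo hi : Fin N → Fin N → Fin N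
    lo a b = if ⌊ a <? b ⌋ then a else b
    hi a b = if ⌊ a <? b ⌋ then b else a

    sorted-cases : ∀ a b → (a < b × lo a b ≡ a × hi a b ≡ b) ⊎ (¬ a < b × lo a b ≡ b × hi a b ≡ a)
    sorted-cases a b = by (a <? b)
      where
      by : (d : Dec (a < b)) → (a < b × (if ⌊ d ⌋ then a else b) ≡ a × (if ⌊ d ⌋ then b else a) ≡ b)
                             ⊎ (¬ a < b × (if ⌊ d ⌋ then a else b) ≡ b × (if ⌊ d ⌋ then b else a) ≡ a)
      by (yes a<b) = inj₁ (a<b , ≡.refl , ≡.refl)
      by (no a≮b)  = inj₂ (a≮b , ≡.refl , ≡.refl)

    cost≈weight-sorted : ∀ a b → a ≢ b → cost (adj G a b) (x a b) ≈ weight (lo a b) (hi a b)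
    cost≈weight-sorted a b a≢b with sorted-cases a b
    ... | inj₁ (a<b , lo≡a , hi≡b) rewrite lo≡a | hi≡b = ≈-sym (indicator-yes (a <? b) a<b)
    ... | inj₂ (a≮b , lo≡b , hi≡a) rewrite lo≡b | hi≡a = begin-equality
      cost (adj G a b) (x a b)  ≈⟨ cost-cong (adj G a b) (symm a b a≢b) ⟩
      cost (adj G a b) (x b a)  ≡⟨ ≡.cong (λ β → cost β (x b a)) (Graph.sym G a b) ⟩
      cost (adj G b a) (x b a)  ≈⟨ indicator-yes (b <? a) (flip-< a≢b a≮b) ⟨
      weight b a                ∎

    Hits : (o : Member) → Fin (n (H o)) → Fin (n (H o)) → Fin N → Fin N → Set
    Hits o u v a b = u < v × lo (π o u) (π o v) ≡ a × hi (π o u) (π o v) ≡ b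

    hits? : ∀ o u v a b → Dec (Hits o u v a b)
    hits? o u v a b = (u <? v) ×-dec (lo (π o u) (π o v) ≟ a) ×-dec (hi (π o u) (π o v) ≟ b)

    share : (o : Member) → Fin (n (H o)) → Fin (n (H o)) → Fin N → Fin N → Carrier
    share o u v a b = indicator (hits? o u v a b) (weight a b)

    -- A term of a constraint row is the sum of its shares over the pairs of G:
    -- for u < v exactly the share at the sorted image pair (ℓ , h) survives.
    term-split : ∀ o u v → indicator (u <? v) (cost (adj (H o) u v) (x (π o u) (π o v)))
                           ≈ ∑[ a < N ] ∑[ b < N ] share o u v a b
    term-split o u v = indicator-cases (u <? v) split-below split-above
      where
      ℓ h : Fin N
      ℓ = lo (π o u) (π o v)
      h = hi (π o u) (π o v)

      split-above : ¬ u < v → ∑[ a < N ] ∑[ b < N ] share o u v a b ≈ 0#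
      split-above u≮v = ∑-vanishes λ a → ∑-vanishes λ b →
        indicator-no (hits? o u v a b) (u≮v ∘ proj₁)

      off-h : ∀ b → b ≢ h → share o u v ℓ b ≈ 0#
      off-h b b≢h = indicator-no (hits? o u v ℓ b) (b≢h ∘ ≡.sym ∘ proj₂ ∘ proj₂)

      off-ℓ : ∀ a → a ≢ ℓ → ∑[ b < N ] share o u v a b ≈ 0#
      off-ℓ a a≢ℓ = ∑-vanishes λ b → indicator-no (hits? o u v a b) (a≢ℓ ∘ ≡.sym ∘ proj₁ ∘ proj₂)

      split-below : u < v → cost (adj (H o) u v) (x (π o u) (π o v))
                            ≈ ∑[ a < N ] ∑[ b < N ] share o u v a b
      split-below u<v = begin-equality
        cost (adj (H o) u v) (x (π o u) (π o v))
          ≡⟨ ≡.cong (λ β → cost β (x (π o u) (π o v))) (induced o u v) ⟩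
        cost (adj G (π o u) (π o v)) (x (π o u) (π o v))
          ≈⟨ cost≈weight-sorted _ _ (<⇒≢ u<v ∘ π-inj o) ⟩
        weight ℓ h
          ≈⟨ indicator-yes (hits? o u v ℓ h) (u<v , ≡.refl , ≡.refl) ⟨
        share o u v ℓ h
          ≈⟨ ∑-delta h off-h ⟨
        ∑[ b < N ] share o u v ℓ b
          ≈⟨ ∑-delta ℓ off-ℓ ⟨
        ∑[ a < N ] ∑[ b < N ] share o u v a b
          ∎

    row-split : ∀ o → constraintLHS G (H o) (π o) x
                      ≈ ∑[ a < N ] ∑[ b < N ] ∑[ u < n (H o) ] ∑[ v < n (H o) ] share o u v a b
    row-split o = ≈-trans (sumFin≈∑ _ λ u → ≈-trans (sumFin≈∑ _ (term-split o u)) (∑-sink (share o u)))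
                          (∑-sink λ u a b → ∑[ v < n (H o) ] share o u v a b)

    -- Two hits of the same sorted pair within one member come from the same
    -- node pair: π is injective, and u < v fixes the orientation.
    hits-endpoints : ∀ o {u v a b} → Hits o u v a b →
                     (π o u ≡ a × π o v ≡ b) ⊎ (π o u ≡ b × π o v ≡ a)
    hits-endpoints o {u} {v} (_ , lo≡a , hi≡b) with sorted-cases (π o u) (π o v)
    ... | inj₁ (_ , lo≡πu , hi≡πv) = inj₁ (≡.trans (≡.sym lo≡πu) lo≡a , ≡.trans (≡.sym hi≡πv) hi≡b)
    ... | inj₂ (_ , lo≡πv , hi≡πu) = inj₂ (≡.trans (≡.sym hi≡πu) hi≡b , ≡.trans (≡.sym lo≡πv) lo≡a)

    same-image : ∀ (o : Member) {u u′ a} → π o u ≡ a → π o u′ ≡ a → u ≡ u′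
    same-image o u↦a u′↦a = π-inj o (≡.trans u↦a (≡.sym u′↦a))

    hits-unique : ∀ o {u v u′ v′ a b} → Hits o u v a b → Hits o u′ v′ a b → u ≡ u′ × v ≡ v′
    hits-unique o hit hit′ with hits-endpoints o hit | hits-endpoints o hit′
    ... | inj₁ (u↦a , v↦b) | inj₁ (u′↦a , v′↦b) = same-image o u↦a u′↦a , same-image o v↦b v′↦b
    ... | inj₂ (u↦b , v↦a) | inj₂ (u′↦b , v′↦a) = same-image o u↦b u′↦b , same-image o v↦a v′↦a
    ... | inj₁ (u↦a , v↦b) | inj₂ (u′↦b , v′↦a) =
      ⊥-elim (crossed (proj₁ hit) (proj₁ hit′) (same-image o u↦a v′↦a) (same-image o v↦b u′↦b))
    ... | inj₂ (u↦b , v↦a) | inj₁ (u′↦a , v′↦b) =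
      ⊥-elim (crossed (proj₁ hit) (proj₁ hit′) (same-image o u↦b v′↦b) (same-image o v↦a u′↦a))

    hits⇒node-pair : ∀ o {u v a b} → Hits o u v a b → NodePairOf o a b
    hits⇒node-pair o {u} {v} hit with hits-endpoints o hit
    ... | inj₁ (u↦a , v↦b) = u , v , <⇒≢ (proj₁ hit) , u↦a , v↦b
    ... | inj₂ (u↦b , v↦a) = v , u , <⇒≢ (proj₁ hit) ∘ ≡.sym , v↦a , u↦b

    charged-to : Fin (length P) → Fin N → Fin N → Carrier
    charged-to k a b = ∑[ u < n (H (member k)) ] ∑[ v < n (H (member k)) ] share (member k) u v a b

    load : Fin N → Fin N → Carrier
    load a b = ∑[ k < length P ] charged-to k a b

    -- A blocked pair is fixed to its value in G, so editing it costs nothing.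
    weight-blocked : ∀ a b → Blocked B a b → weight a b ≈ 0#
    weight-blocked a b blocked = indicator-when (a <? b) (fixed-cost ∘ <⇒≢)
      where
      fixed-cost : a ≢ b → cost (adj G a b) (x a b) ≈ 0#
      fixed-cost a≢b with adj G a b in edge
      ... | true  = ≈-trans (+-congˡ (-‿cong (blockedE a b a≢b blocked edge))) (-‿inverseʳ 1#)
      ... | false = blockedN a b a≢b blocked edge

    load-vanishes : ∀ a b → weight a b ≈ 0# → load a b ≈ 0#
    load-vanishes a b w≈0 = ∑-vanishes λ k → ∑-vanishes λ u → ∑-vanishes λ v →
      indicator-when (hits? (member k) u v a b) (λ _ → w≈0)

    -- An unblocked pair is hit at most once by the whole packing: within a
    -- member by hits-unique, across members by pair-disjointness.
    load-free : ∀ a b → ¬ Blocked B a b → load a b ≤ weight a b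
    load-free a b free = proj₁ (∑-charged 0≤w member-charged one-member)
      where
      0≤w : 0# ≤ weight a b
      0≤w = weight-nonneg a b

      member-charged : ∀ k → Charged (weight a b) (NodePairOf (member k) a b) (charged-to k a b)
      member-charged k = charged-map (λ (_ , _ , hit) → hits⇒node-pair o hit)
        (∑-charged 0≤w
          (λ u → ∑-charged 0≤w (λ v → indicator-charged (hits? o u v a b) 0≤w)
                               (λ v v′ hit hit′ → proj₂ (hits-unique o hit hit′)))
          (λ u u′ (_ , hit) (_ , hit′) → proj₁ (hits-unique o hit hit′)))
        where
        o : Member
        o = member k

      one-member : ∀ k l → NodePairOf (member k) a b → NodePairOf (member l) a b → k ≡ l
      one-member k l in-k in-l with k ≟ l
      ... | yes k≡l = k≡l
      ... | no  k≢l = ⊥-elim (disjoint k l k≢l a b free in-k in-l)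

    load≤weight : ∀ a b → load a b ≤ weight a b
    load≤weight a b with T? (B a b ∨ B b a)
    ... | no  free    = load-free a b free
    ... | yes blocked = reflexive (≈-trans (load-vanishes a b w≈0) (≈-sym w≈0))
      where
      w≈0 : weight a b ≈ 0#
      w≈0 = weight-blocked a b blocked

mainTheorem2 : ∀ {c ℓ₁ ℓ₂} (R : OrderedCommutativeRing c ℓ₁ ℓ₂)
    (𝓕 : List Graph) (G : Graph) (B : Fin (n G) → Fin (n G) → Bool)
    (P : List (InducedForbidden 𝓕 G)) → PairDisjoint G B P →
    (x : LP.Assignment R G) → LP.Feasible R 𝓕 G B x →
    OrderedCommutativeRing._≤_ R (LP.fromℕ R (length P)) (LP.objective R G x)
mainTheorem2 R 𝓕 G B P disjoint x feasible = begin
  fromℕ K                                            ≈⟨ fromℕ≈∑1 K ⟩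
  ∑[ k < K ] 1#                                      ≤⟨ ∑-mono-≤ row≥1 ⟩
  ∑[ k < K ] row k                                   ≈⟨ sum-cong-≋ (row-split ∘ member) ⟩
  ∑[ k < K ] ∑[ a < N ] ∑[ b < N ] charged-to k a b  ≈⟨ ∑-sink charged-to ⟩
  ∑[ a < N ] ∑[ b < N ] load a b                     ≤⟨ ∑-mono-≤ (∑-mono-≤ ∘ load≤weight) ⟩
  ∑[ a < N ] ∑[ b < N ] weight a b                   ≈⟨ objective≈∑weight ⟨
  objective G x                                      ∎
  where
  open OrderedCommutativeRing R using (Carrier; _≤_; 1#; +-commutativeMonoid)
  open MonoidSum +-commutativeMonoid using (sum-syntax; sum-cong-≋)
  open LP R using (fromℕ; objective; constraintLHS; module Feasible)
  open PackingBound R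
  open PartialOrderReasoning poset
  open Packing 𝓕 G B P disjoint x feasible
  open Feasible feasible using (forbidden)

  K : ℕ
  K = length P

  row : Fin K → Carrier
  row k = constraintLHS G (H (member k)) (π (member k)) x

  row≥1 : ∀ k → 1# ≤ row k
  row≥1 k = forbidden (H (member k)) (H∈𝓕 (member k)) (π (member k)) (π-inj (member k))
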